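{- In the setting below, suppose $|\tilde a(\tilde\mu)|=|\beta_i-\beta'_j|$ for some $(i,j)\in S^+$. Then there is no $w\in W^P$ such that $\tilde\mu+\boldsymbol\rho_N=w(\lambda+\boldsymbol\rho_N)$ with a dominant weight $\lambda\in\mathbb Z^N$.
   Context: Let $n$ be even, $n'\ge1$, $N=n+n'$. Let $\mu=(b_1\ge\dots\ge b_n)\in\mathbb Z^n$ with $a_i:=b_i-b_{i+1}+1$ satisfying $a_{n-i}=a_i$, $d=(b_1+\dots+b_n)/n$, and $\beta_j=b_j+\frac{n+1}2-j-d=\frac12\big(\sum_{i=j}^{n-1}a_i-\sum_{i=1}^{j-1}a_i\big)$, so $\beta_1>\dots>\beta_n$ and $\beta_{n+1-j}=-\beta_j$. Similarly $\mu'=(b'_1\ge\dots\ge b'_{n'})\in\mathbb Z^{n'}$ with $d'$, $\beta'_j$. Assume $\beta_i+\beta'_j\neq0$ for all $(i,j)\in S=\{1,\dots,n\}\times\{1,\dots,n'\}$. Let $S^+=\{(i,j)\in S: 1\le i\le\frac{n+1}2,\ 1\le j\le\frac{n'+1}2\}$, $\tilde\mu=(\mu,\mu')\in\mathbb Z^N$, $\tilde a(\tilde\mu)=d-d'+\frac N2$, $\boldsymbol\rho_N=(\frac{N-1}2,\frac{N-3}2,\dots,\frac{1-N}2)$. $W=S_N$ acts on $\mathbb Q^N$ by $(wx)_i=x_{w^{ -1}(i)}$; $P$ is the standard parabolic of type $(n,n')$ and $W^P=\{w\in S_N: w^{ -1}(i)<w^{ -1}(i+1)\ \text{for}\ i\neq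 n\}$. A weight is dominant if its coordinates are non-increasing. -}

module Defs where

open import Data.Nat as ℕ using (ℕ; zero; suc; NonZero)
open import Data.Fin as Fin using (Fin; toℕ; opposite)
open import Data.Fin.Permutation using (Permutation′; _⟨$⟩ˡ_)
open import Data.Integer as ℤ using (ℤ; +_)
open import Data.Rational as ℚ using (ℚ; ½; _/_; _+_; _-_; _*_; ∣_∣)
open import Data.Vec.Functional using (Vector; _++_)
open import Relation.Binary.PropositionalEquality using (_≡_; _≢_)
open import Relation.Nullary using (¬_)

-- Integer vectors in ℤ^n are functions Fin n → ℤ; index k : Fin n is the
-- paper's index k+1 (0-based indexing).

ℕtoℚ : ℕ → ℚ
ℕtoℚ m = + m / 1

ℤtoℚ : ℤ → ℚ
ℤtoℚ z = z / 1

sumℤ : ∀ {n} → Vector ℤ n → ℤ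
sumℤ {zero} v = + 0
sumℤ {suc n} v = v Fin.zero ℤ.+ sumℤ {n} (λ k → v (Fin.suc k))

Dominant : ∀ {n} → Vector ℤ n → Set
Dominant {n} v = ∀ (i j : Fin n) → i Fin.≤ j → v j ℤ.≤ v i

-- a_i := b_i - b_{i+1} + 1, where b_i = v i₀ and b_{i+1} = v j₀ with toℕ j₀ = suc (toℕ i₀)
aAt : ∀ {n} → Vector ℤ n → Fin n → Fin n → ℤ
aAt v i j = v i ℤ.- v j ℤ.+ + 1

-- a_{n-i} = a_i for i = 1, …, n-1.  In 0-based indices: the pair (i₀, i₀+1)
-- gives a_i, and a_{n-i} = b_{n-i} - b_{n-i+1} + 1 is given by the pair
-- (opposite (i₀+1), opposite i₀).
SymmetricA : ∀ {n} → Vector ℤ n → Set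
SymmetricA {n} v = ∀ (i j : Fin n) → toℕ j ≡ suc (toℕ i) →
  aAt v (opposite j) (opposite i) ≡ aAt v i j

dd : ∀ {n} .{{_ : NonZero n}} → Vector ℤ n → ℚ
dd {n} v = sumℤ v / n

β : ∀ {n} .{{_ : NonZero n}} → Vector ℤ n → Fin n → ℚ
β {n} v j = ℤtoℚ (v j) + (ℕtoℚ (suc n) * ½) - ℕtoℚ (suc (toℕ j)) - dd v

-- index (paper) i with 1 ≤ i ≤ (n+1)/2, i.e. 2 i ≤ n + 1
InHalf : ∀ {n} → Fin n → Set
InHalf {n} i = 2 ℕ.* suc (toℕ i) ℕ.≤ suc n

aTilde : ∀ {n n'} .{{_ : NonZero n}} .{{_ : NonZero n'}} →
  Vector ℤ n → Vector ℤ n' → ℚ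
aTilde {n} {n'} μ μ' = dd μ - dd μ' + ℕtoℚ (n ℕ.+ n') * ½

ρ : (N : ℕ) → Vector ℚ N
ρ N k = ℕtoℚ (suc N) * ½ - ℕtoℚ (suc (toℕ k))

-- action of S_N on ℚ^N: (w x)_i = x_{w⁻¹(i)}
act : ∀ {N} → Permutation′ N → Vector ℚ N → Vector ℚ N
act w x i = x (w ⟨$⟩ˡ i)

-- W^P for P of type (n, n'): w⁻¹(i) < w⁻¹(i+1) for all i ≠ n (paper 1-based i)
InWP : (n n' : ℕ) → Permutation′ (n ℕ.+ n') → Set
InWP n n' w = ∀ (i j : Fin (n ℕ.+ n')) → toℕ j ≡ suc (toℕ i) → suc (toℕ i) ≢ n →
  (w ⟨$⟩ˡ i) Fin.< (w ⟨$⟩ˡ j)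

plusρ : ∀ {N} → Vector ℤ N → Vector ℚ N
plusρ {N} x k = ℤtoℚ (x k) + ρ N k

{-# OPTIONS --safe #-}
-- Since λ is dominant, λ + ρ_N has pairwise distinct coordinates, hence so
-- has its permutation μ̃ + ρ_N.  The coordinates i and n + j of μ̃ + ρ_N differ
-- by ã(μ̃) + β_i - β'_j, and the symmetry a_{n-i} = a_i of μ gives
-- β_{n+1-i} = -β_i (likewise for μ').  So if ã = -(β_i - β'_j) the coordinates
-- i and n + j coincide, and if ã = β_i - β'_j the coordinates n + 1 - i and
-- n + n' + 1 - j do.
module Submission where

open import Defs
open import Data.Nat as ℕ using (ℕ; NonZero; zero; suc)
open import Data.Nat.Divisibility using (_∣_)
open import Data.Fin using (Fin; toℕ; opposite; inject₁; splitAt; _↑ˡ_; _↑ʳ_)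
open import Data.Fin.Permutation using (Permutation′; _⟨$⟩ˡ_; _⟨$⟩ʳ_; inverseʳ; reverse)
open import Data.Integer using (ℤ; +_)
open import Data.Rational using (ℚ; _+_; _-_; ∣_∣; 0ℚ; _*_; -_; ½; 1/_; toℚᵘ)
open import Data.Vec.Functional using (Vector; _++_)
open import Data.Product using (Σ; _×_; ∃₂; _,_)
open import Relation.Binary.PropositionalEquality using (_≡_; _≢_)
open import Relation.Nullary using (¬_)

import Data.Nat.Properties as ℕP
import Data.Fin.Properties as FP
import Data.Fin as Fin
open import Data.Fin.Induction using (<-weakInduction)
import Data.Integer as ℤ
import Data.Integer.Properties as ℤP
import Data.Rational as ℚ
import Data.Rational.Properties as ℚP
open import Data.Rational.Unnormalised as ℚᵘ using (mkℚᵘ; *≡*) renaming (_≃_ to _≃ᵘ_)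
import Data.Rational.Unnormalised.Properties as ℚᵘP
open import Data.Vec.Functional.Properties using (lookup-++ˡ; lookup-++ʳ)
open import Data.Sum using (_⊎_; inj₁; inj₂)
open import Function.Definitions using (Injective)
open import Level using (0ℓ)
open import Relation.Binary.Definitions using (tri<; tri≈; tri>)
open import Relation.Binary.PropositionalEquality using (refl; sym; trans; cong; cong₂; module ≡-Reasoning)
open import Relation.Nullary using (contradiction)
open import Relation.Nullary.Decidable using (dec⇒maybe)
open import Algebra.Properties.CommutativeMonoid.Sum ℤP.+-0-commutativeMonoid
  using (sum; sum-cong-≗; ∑-distrib-+; sum-permute)
open import Algebra.Properties.Group ℚP.+-0-group using (inverseˡ-unique; x∙y⁻¹≈ε⇒x≈y; ⁻¹-involutive)
open import Data.Integer.Tactic.RingSolver as ℤ-Solver using ()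
open import Tactic.RingSolver using (solve-∀)
open import Tactic.RingSolver.Core.AlmostCommutativeRing
  using (AlmostCommutativeRing; fromCommutativeRing)

ℚ-ring : AlmostCommutativeRing 0ℓ 0ℓ
ℚ-ring = fromCommutativeRing ℚP.+-*-commutativeRing (λ x → dec⇒maybe (0ℚ ℚP.≟ x))

toℚᵘ-ℤtoℚ : ∀ z → toℚᵘ (ℤtoℚ z) ≃ᵘ mkℚᵘ z 0
toℚᵘ-ℤtoℚ z = ℚP.toℚᵘ-fromℚᵘ (mkℚᵘ z 0)

ℤtoℚ-+ : ∀ a b → ℤtoℚ (a ℤ.+ b) ≡ ℤtoℚ a + ℤtoℚ b
ℤtoℚ-+ a b = ℚP.toℚᵘ-injective (begin
  toℚᵘ (ℤtoℚ (a ℤ.+ b))          ≈⟨ toℚᵘ-ℤtoℚ (a ℤ.+ b) ⟩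
  mkℚᵘ (a ℤ.+ b) 0               ≈⟨ *≡* (cross-multiplied a b) ⟩
  mkℚᵘ a 0 ℚᵘ.+ mkℚᵘ b 0         ≈⟨ ℚᵘP.+-cong (toℚᵘ-ℤtoℚ a) (toℚᵘ-ℤtoℚ b) ⟨
  toℚᵘ (ℤtoℚ a) ℚᵘ.+ toℚᵘ (ℤtoℚ b) ≈⟨ ℚP.toℚᵘ-homo-+ (ℤtoℚ a) (ℤtoℚ b) ⟨
  toℚᵘ (ℤtoℚ a + ℤtoℚ b)         ∎)
  where
  open ℚᵘP.≃-Reasoning
  cross-multiplied : ∀ a b → (a ℤ.+ b) ℤ.* + 1 ≡ (a ℤ.* + 1 ℤ.+ b ℤ.* + 1) ℤ.* + 1
  cross-multiplied = ℤ-Solver.solve-∀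

ℤtoℚ-* : ∀ a b → ℤtoℚ (a ℤ.* b) ≡ ℤtoℚ a * ℤtoℚ b
ℤtoℚ-* a b = ℚP.toℚᵘ-injective (begin
  toℚᵘ (ℤtoℚ (a ℤ.* b))          ≈⟨ toℚᵘ-ℤtoℚ (a ℤ.* b) ⟩
  mkℚᵘ a 0 ℚᵘ.* mkℚᵘ b 0         ≈⟨ ℚᵘP.*-cong (toℚᵘ-ℤtoℚ a) (toℚᵘ-ℤtoℚ b) ⟨
  toℚᵘ (ℤtoℚ a) ℚᵘ.* toℚᵘ (ℤtoℚ b) ≈⟨ ℚP.toℚᵘ-homo-* (ℤtoℚ a) (ℤtoℚ b) ⟨
  toℚᵘ (ℤtoℚ a * ℤtoℚ b)         ∎)
  where open ℚᵘP.≃-Reasoning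

ℤtoℚ-injective : Injective _≡_ _≡_ ℤtoℚ
ℤtoℚ-injective {a} {b} e with ℚᵘP.≃-trans (ℚᵘP.≃-sym (toℚᵘ-ℤtoℚ a))
                                (ℚᵘP.≃-trans (ℚᵘP.≃-reflexive (cong toℚᵘ e)) (toℚᵘ-ℤtoℚ b))
... | *≡* a*1≡b*1 = trans (sym (ℤP.*-identityʳ a)) (trans a*1≡b*1 (ℤP.*-identityʳ b))

ℕtoℚ-+ : ∀ m n → ℕtoℚ (m ℕ.+ n) ≡ ℕtoℚ m + ℕtoℚ n
ℕtoℚ-+ m n = ℤtoℚ-+ (+ m) (+ n)

ℕtoℚ-nonZero : ∀ n .{{_ : NonZero n}} → ℚ.NonZero (ℕtoℚ n)
ℕtoℚ-nonZero (suc k) = ℚP.pos⇒nonZero (ℕtoℚ (suc k)) {{ℚP.normalize-pos (suc k) 1}}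

/-*-ℕtoℚ : ∀ z n .{{_ : NonZero n}} → (z ℚ./ n) * ℕtoℚ n ≡ ℤtoℚ z
/-*-ℕtoℚ z (suc k) = ℚP.toℚᵘ-injective (begin
  toℚᵘ ((z ℚ./ suc k) * ℕtoℚ (suc k))            ≈⟨ ℚP.toℚᵘ-homo-* (z ℚ./ suc k) (ℕtoℚ (suc k)) ⟩
  toℚᵘ (z ℚ./ suc k) ℚᵘ.* toℚᵘ (ℕtoℚ (suc k))    ≈⟨ ℚᵘP.*-cong (ℚP.toℚᵘ-fromℚᵘ (mkℚᵘ z k))
                                                                 (toℚᵘ-ℤtoℚ (+ suc k)) ⟩
  mkℚᵘ z k ℚᵘ.* mkℚᵘ (+ suc k) 0                 ≈⟨ *≡* (cross-multiplied z k) ⟩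
  mkℚᵘ z 0                                        ≈⟨ toℚᵘ-ℤtoℚ z ⟨
  toℚᵘ (ℤtoℚ z)                                   ∎)
  where
  open ℚᵘP.≃-Reasoning
  cross-multiplied : ∀ z k → z ℤ.* + suc k ℤ.* + 1 ≡ z ℤ.* + (suc k ℕ.* 1)
  cross-multiplied z k = trans (ℤP.*-identityʳ _) (cong (λ m → z ℤ.* + m) (sym (ℕP.*-identityʳ (suc k))))

*-cancelʳ-≡ : ∀ {p q} r .{{_ : ℚ.NonZero r}} → p * r ≡ q * r → p ≡ q
*-cancelʳ-≡ {p} {q} r pr≡qr = begin
  p                ≡⟨ undo p ⟨
  p * r * (1/ r)   ≡⟨ cong (_* (1/ r)) pr≡qr ⟩
  q * r * (1/ r)   ≡⟨ undo q ⟩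
  q                ∎
  where
  open ≡-Reasoning
  undo : ∀ x → x * r * (1/ r) ≡ x
  undo x = trans (ℚP.*-assoc x r (1/ r)) (trans (cong (x *_) (ℚP.*-inverseʳ r)) (ℚP.*-identityʳ x))

sumℤ≡sum : ∀ {n} (v : Vector ℤ n) → sumℤ v ≡ sum v
sumℤ≡sum {zero}  v = refl
sumℤ≡sum {suc n} v = cong (ℤ._+_ (v Fin.zero)) (sumℤ≡sum (λ k → v (Fin.suc k)))

sum-const : ∀ n c → sum {n} (λ _ → c) ≡ + n ℤ.* c
sum-const zero    c = sym (ℤP.*-zeroˡ c)
sum-const (suc n) c = trans (cong (ℤ._+_ c) (sum-const n c)) (sym (ℤP.suc-* (+ n) c))

pairSum-const⇒sum : ∀ {n} (v : Vector ℤ n) c → (∀ i → v i ℤ.+ v (opposite i) ≡ c) →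
  + n ℤ.* c ≡ sumℤ v ℤ.+ sumℤ v
pairSum-const⇒sum {n} v c pairSum≡c = begin
  + n ℤ.* c                              ≡⟨ sum-const n c ⟨
  sum {n} (λ _ → c)                      ≡⟨ sum-cong-≗ (λ i → sym (pairSum≡c i)) ⟩
  sum (λ i → v i ℤ.+ v (opposite i))     ≡⟨ ∑-distrib-+ v (λ i → v (opposite i)) ⟩
  sum v ℤ.+ sum (λ i → v (opposite i))   ≡⟨ cong (ℤ._+_ (sum v)) (sum-permute v reverse) ⟨
  sum v ℤ.+ sum v                        ≡⟨ cong₂ ℤ._+_ (sumℤ≡sum v) (sumℤ≡sum v) ⟨
  sumℤ v ℤ.+ sumℤ v                      ∎
  where open ≡-Reasoning

symmetricA⇒pairSum-step : ∀ {n} (v : Vector ℤ n) → SymmetricA v → ∀ i j → toℕ j ≡ suc (toℕ i) →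
  v j ℤ.+ v (opposite j) ≡ v i ℤ.+ v (opposite i)
symmetricA⇒pairSum-step v symmetric i j j≡1+i = begin
  v j ℤ.+ v (opposite j)                                              ≡⟨ insert (v j) (v (opposite j)) (v (opposite i)) ⟩
  v j ℤ.+ aAt v (opposite j) (opposite i) ℤ.+ v (opposite i) ℤ.- + 1  ≡⟨ cong (λ a → v j ℤ.+ a ℤ.+ _ ℤ.- + 1)
                                                                          (symmetric i j j≡1+i) ⟩
  v j ℤ.+ aAt v i j ℤ.+ v (opposite i) ℤ.- + 1                        ≡⟨ remove (v j) (v i) (v (opposite i)) ⟩
  v i ℤ.+ v (opposite i)                                              ∎
  where
  open ≡-Reasoning
  insert : ∀ x y w → x ℤ.+ y ≡ x ℤ.+ (y ℤ.- w ℤ.+ + 1) ℤ.+ w ℤ.- + 1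
  insert = ℤ-Solver.solve-∀
  remove : ∀ x y w → x ℤ.+ (y ℤ.- x ℤ.+ + 1) ℤ.+ w ℤ.- + 1 ≡ y ℤ.+ w
  remove = ℤ-Solver.solve-∀

symmetricA⇒pairSum-const : ∀ {m} (v : Vector ℤ (suc m)) → SymmetricA v → ∀ i →
  v i ℤ.+ v (opposite i) ≡ v Fin.zero ℤ.+ v (opposite Fin.zero)
symmetricA⇒pairSum-const v symmetric = <-weakInduction _ refl λ i pairSum≡ →
  trans (symmetricA⇒pairSum-step v symmetric (inject₁ i) (Fin.suc i) (cong suc (sym (FP.toℕ-inject₁ i))))
        pairSum≡

symmetricA⇒pairSum≡2d : ∀ {n} .{{_ : NonZero n}} (μ : Vector ℤ n) → SymmetricA μ → ∀ i →
  ℤtoℚ (μ i) + ℤtoℚ (μ (opposite i)) ≡ dd μ + dd μ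
symmetricA⇒pairSum≡2d {suc m} μ symmetric i = *-cancelʳ-≡ n {{ℕtoℚ-nonZero (suc m)}} (begin
  (ℤtoℚ (μ i) + ℤtoℚ (μ (opposite i))) * n  ≡⟨ cong (_* n) (ℤtoℚ-+ (μ i) (μ (opposite i))) ⟨
  ℤtoℚ c * n                                ≡⟨ ℤtoℚ-* c (+ suc m) ⟨
  ℤtoℚ (c ℤ.* + suc m)                      ≡⟨ cong ℤtoℚ (trans (ℤP.*-comm c (+ suc m)) n*c≡2s) ⟩
  ℤtoℚ (s ℤ.+ s)                            ≡⟨ ℤtoℚ-+ s s ⟩
  ℤtoℚ s + ℤtoℚ s                           ≡⟨ cong₂ _+_ (/-*-ℕtoℚ s (suc m)) (/-*-ℕtoℚ s (suc m)) ⟨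
  dd μ * n + dd μ * n                       ≡⟨ ℚP.*-distribʳ-+ n (dd μ) (dd μ) ⟨
  (dd μ + dd μ) * n                         ∎)
  where
  open ≡-Reasoning
  n = ℕtoℚ (suc m)
  c = μ i ℤ.+ μ (opposite i)
  s = sumℤ μ
  n*c≡2s : + suc m ℤ.* c ≡ s ℤ.+ s
  n*c≡2s = pairSum-const⇒sum μ c λ k →
    trans (symmetricA⇒pairSum-const μ symmetric k) (sym (symmetricA⇒pairSum-const μ symmetric i))

toℕ-opposite-+ : ∀ {n} (i : Fin n) → suc (toℕ (opposite i)) ℕ.+ suc (toℕ i) ≡ suc n
toℕ-opposite-+ {n} i = begin
  suc (toℕ (opposite i)) ℕ.+ suc (toℕ i)  ≡⟨ cong (λ k → suc k ℕ.+ suc (toℕ i)) (FP.opposite-prop i) ⟩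
  suc (n ℕ.∸ suc (toℕ i) ℕ.+ suc (toℕ i)) ≡⟨ cong suc (ℕP.m∸n+n≡m (FP.toℕ<n i)) ⟩
  suc n                                    ∎
  where open ≡-Reasoning

symmetricA⇒β-opposite : ∀ {n} .{{_ : NonZero n}} (μ : Vector ℤ n) → SymmetricA μ → ∀ i →
  β μ (opposite i) ≡ - β μ i
symmetricA⇒β-opposite {n} μ symmetric i = inverseˡ-unique (β μ (opposite i)) (β μ i) (begin
  β μ (opposite i) + β μ i                                   ≡⟨ regroup b b̄ (dd μ) n+1 ī+1 i+1 ⟩
  (b + b̄ - (dd μ + dd μ)) + (n+1 - (ī+1 + i+1))              ≡⟨ cong₂ (λ x y → (x - (dd μ + dd μ)) + (n+1 - y))
                                                                      (symmetricA⇒pairSum≡2d μ symmetric i) index-sum ⟩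
  (dd μ + dd μ - (dd μ + dd μ)) + (n+1 - n+1)                ≡⟨ cancel (dd μ + dd μ) n+1 ⟩
  0ℚ                                                         ∎)
  where
  open ≡-Reasoning
  b = ℤtoℚ (μ i)
  b̄ = ℤtoℚ (μ (opposite i))
  n+1 = ℕtoℚ (suc n)
  i+1 = ℕtoℚ (suc (toℕ i))
  ī+1 = ℕtoℚ (suc (toℕ (opposite i)))
  index-sum : ī+1 + i+1 ≡ n+1
  index-sum = trans (sym (ℕtoℚ-+ (suc (toℕ (opposite i))) (suc (toℕ i)))) (cong ℕtoℚ (toℕ-opposite-+ i))
  regroup : ∀ b b̄ d s t̄ t → (b̄ + s * ½ - t̄ - d) + (b + s * ½ - t - d) ≡ (b + b̄ - (d + d)) + (s - (t̄ + t))
  regroup = solve-∀ ℚ-ring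
  cancel : ∀ x y → (x - x) + (y - y) ≡ 0ℚ
  cancel = solve-∀ ℚ-ring

plusρ-++-↑ˡ : ∀ {n n'} .{{_ : NonZero n}} (μ : Vector ℤ n) (μ' : Vector ℤ n') i →
  plusρ (μ ++ μ') (i ↑ˡ n') ≡ β μ i + dd μ + ℕtoℚ n' * ½
plusρ-++-↑ˡ {n} {n'} μ μ' i = begin
  plusρ (μ ++ μ') (i ↑ˡ n')                    ≡⟨ cong₂ (λ x k → ℤtoℚ x + (ℕtoℚ (suc n ℕ.+ n') * ½ - ℕtoℚ (suc k)))
                                                        (lookup-++ˡ μ μ' i) (FP.toℕ-↑ˡ i n') ⟩
  b + (ℕtoℚ (suc n ℕ.+ n') * ½ - t)            ≡⟨ cong (λ x → b + (x * ½ - t)) (ℕtoℚ-+ (suc n) n') ⟩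
  b + ((ℕtoℚ (suc n) + ℕtoℚ n') * ½ - t)       ≡⟨ regroup b (ℕtoℚ (suc n)) (ℕtoℚ n') t (dd μ) ⟩
  β μ i + dd μ + ℕtoℚ n' * ½                   ∎
  where
  open ≡-Reasoning
  b = ℤtoℚ (μ i)
  t = ℕtoℚ (suc (toℕ i))
  regroup : ∀ b s n' t d → b + ((s + n') * ½ - t) ≡ b + s * ½ - t - d + d + n' * ½
  regroup = solve-∀ ℚ-ring

plusρ-++-↑ʳ : ∀ {n n'} .{{_ : NonZero n'}} (μ : Vector ℤ n) (μ' : Vector ℤ n') j →
  plusρ (μ ++ μ') (n ↑ʳ j) ≡ β μ' j + dd μ' - ℕtoℚ n * ½
plusρ-++-↑ʳ {n} {n'} μ μ' j = begin
  plusρ (μ ++ μ') (n ↑ʳ j)                                      ≡⟨ cong₂ (λ x k → ℤtoℚ x + (ℕtoℚ (suc (n ℕ.+ n')) * ½ - ℕtoℚ (suc k)))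
                                                                         (lookup-++ʳ μ μ' j) (FP.toℕ-↑ʳ n j) ⟩
  b + (ℕtoℚ (suc (n ℕ.+ n')) * ½ - ℕtoℚ (suc (n ℕ.+ toℕ j)))   ≡⟨ cong₂ (λ x y → b + (x * ½ - y)) (shift n') (shift (toℕ j)) ⟩
  b + ((ℕtoℚ n + ℕtoℚ (suc n')) * ½ - (ℕtoℚ n + t))             ≡⟨ regroup b (ℕtoℚ n) (ℕtoℚ (suc n')) t (dd μ') ⟩
  β μ' j + dd μ' - ℕtoℚ n * ½                                   ∎
  where
  open ≡-Reasoning
  b = ℤtoℚ (μ' j)
  t = ℕtoℚ (suc (toℕ j))
  shift : ∀ k → ℕtoℚ (suc (n ℕ.+ k)) ≡ ℕtoℚ n + ℕtoℚ (suc k)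
  shift k = trans (cong ℕtoℚ (sym (ℕP.+-suc n k))) (ℕtoℚ-+ n (suc k))
  regroup : ∀ b n s t d → b + ((n + s) * ½ - (n + t)) ≡ b + s * ½ - t - d + d - n * ½
  regroup = solve-∀ ℚ-ring

plusρ-++-gap : ∀ {n n'} .{{_ : NonZero n}} .{{_ : NonZero n'}} (μ : Vector ℤ n) (μ' : Vector ℤ n') i j →
  plusρ (μ ++ μ') (i ↑ˡ n') - plusρ (μ ++ μ') (n ↑ʳ j) ≡ aTilde μ μ' - (β μ' j - β μ i)
plusρ-++-gap {n} {n'} μ μ' i j = begin
  plusρ (μ ++ μ') (i ↑ˡ n') - plusρ (μ ++ μ') (n ↑ʳ j)            ≡⟨ cong₂ _-_ (plusρ-++-↑ˡ μ μ' i) (plusρ-++-↑ʳ μ μ' j) ⟩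
  (β μ i + dd μ + ℕtoℚ n' * ½) - (β μ' j + dd μ' - ℕtoℚ n * ½)    ≡⟨ regroup (β μ i) (β μ' j) (dd μ) (dd μ') (ℕtoℚ n) (ℕtoℚ n') ⟩
  dd μ - dd μ' + (ℕtoℚ n + ℕtoℚ n') * ½ - (β μ' j - β μ i)       ≡⟨ cong (λ x → dd μ - dd μ' + x * ½ - (β μ' j - β μ i))
                                                                           (ℕtoℚ-+ n n') ⟨
  aTilde μ μ' - (β μ' j - β μ i)                                  ∎
  where
  open ≡-Reasoning
  regroup : ∀ b b' d d' n n' → (b + d + n' * ½) - (b' + d' - n * ½) ≡ d - d' + (n + n') * ½ - (b' - b)
  regroup = solve-∀ ℚ-ring

aTilde≡β-difference⇒collision : ∀ {n n'} .{{_ : NonZero n}} .{{_ : NonZero n'}}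
  (μ : Vector ℤ n) (μ' : Vector ℤ n') i j → aTilde μ μ' ≡ β μ' j - β μ i →
  plusρ (μ ++ μ') (i ↑ˡ n') ≡ plusρ (μ ++ μ') (n ↑ʳ j)
aTilde≡β-difference⇒collision μ μ' i j ã≡β'j-βi = x∙y⁻¹≈ε⇒x≈y _ _
  (trans (plusρ-++-gap μ μ' i j) (trans (cong (_- (β μ' j - β μ i)) ã≡β'j-βi) (ℚP.+-inverseʳ (β μ' j - β μ i))))

∣p∣≡∣q∣⇒p≡q⊎p≡-q : ∀ p q → ∣ p ∣ ≡ ∣ q ∣ → p ≡ q ⊎ p ≡ - q
∣p∣≡∣q∣⇒p≡q⊎p≡-q p q ∣p∣≡∣q∣ with ℚP.∣p∣≡p∨∣p∣≡-p p | ℚP.∣p∣≡p∨∣p∣≡-p q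
... | inj₁ ∣p∣≡p  | inj₁ ∣q∣≡q  = inj₁ (trans (sym ∣p∣≡p) (trans ∣p∣≡∣q∣ ∣q∣≡q))
... | inj₁ ∣p∣≡p  | inj₂ ∣q∣≡-q = inj₂ (trans (sym ∣p∣≡p) (trans ∣p∣≡∣q∣ ∣q∣≡-q))
... | inj₂ ∣p∣≡-p | inj₁ ∣q∣≡q  = inj₂ (trans (sym (⁻¹-involutive p)) (cong -_ (trans (sym ∣p∣≡-p) (trans ∣p∣≡∣q∣ ∣q∣≡q))))
... | inj₂ ∣p∣≡-p | inj₂ ∣q∣≡-q = inj₁ (ℚP.neg-injective (trans (sym ∣p∣≡-p) (trans ∣p∣≡∣q∣ ∣q∣≡-q)))

∣aTilde∣≡∣β-difference∣⇒aTilde≡β-difference : ∀ {n n'} .{{_ : NonZero n}} .{{_ : NonZero n'}}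
  (μ : Vector ℤ n) (μ' : Vector ℤ n') → SymmetricA μ → SymmetricA μ' → ∀ i j →
  ∣ aTilde μ μ' ∣ ≡ ∣ β μ i - β μ' j ∣ → ∃₂ λ p q → aTilde μ μ' ≡ β μ' q - β μ p
∣aTilde∣≡∣β-difference∣⇒aTilde≡β-difference μ μ' symμ symμ' i j ∣ã∣≡∣βi-β'j∣
  with ∣p∣≡∣q∣⇒p≡q⊎p≡-q (aTilde μ μ') (β μ i - β μ' j) ∣ã∣≡∣βi-β'j∣
... | inj₂ ã≡-[βi-β'j] = i , j , trans ã≡-[βi-β'j] (swap (β μ i) (β μ' j))
  where
  swap : ∀ x y → - (x - y) ≡ y - x
  swap = solve-∀ ℚ-ring
... | inj₁ ã≡βi-β'j = opposite i , opposite j , (begin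
  aTilde μ μ'                                    ≡⟨ ã≡βi-β'j ⟩
  β μ i - β μ' j                                 ≡⟨ swap (β μ i) (β μ' j) ⟩
  - β μ' j - - β μ i                             ≡⟨ cong₂ _-_ (symmetricA⇒β-opposite μ' symμ' j)
                                                              (symmetricA⇒β-opposite μ symμ i) ⟨
  β μ' (opposite j) - β μ (opposite i)           ∎)
  where
  open ≡-Reasoning
  swap : ∀ x y → x - y ≡ - y - - x
  swap = solve-∀ ℚ-ring

plusρ-≡⇒shifted-≡ : ∀ {N} (x : Vector ℤ N) p q → plusρ x p ≡ plusρ x q →
  x p ℤ.+ + suc (toℕ q) ≡ x q ℤ.+ + suc (toℕ p)
plusρ-≡⇒shifted-≡ {N} x p q xp+ρp≡xq+ρq = ℤtoℚ-injective (begin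
  ℤtoℚ (x p ℤ.+ + suc (toℕ q))          ≡⟨ ℤtoℚ-+ (x p) (+ suc (toℕ q)) ⟩
  ℤtoℚ (x p) + t                        ≡⟨ cancel (ℤtoℚ (x p)) K s t ⟨
  plusρ x p + (s + t - K)               ≡⟨ cong (_+ (s + t - K)) xp+ρp≡xq+ρq ⟩
  plusρ x q + (s + t - K)               ≡⟨ cong (λ y → plusρ x q + (y - K)) (ℚP.+-comm s t) ⟩
  plusρ x q + (t + s - K)               ≡⟨ cancel (ℤtoℚ (x q)) K t s ⟩
  ℤtoℚ (x q) + s                        ≡⟨ ℤtoℚ-+ (x q) (+ suc (toℕ p)) ⟨
  ℤtoℚ (x q ℤ.+ + suc (toℕ p))          ∎)
  where
  open ≡-Reasoning
  K = ℕtoℚ (suc N) * ½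
  s = ℕtoℚ (suc (toℕ p))
  t = ℕtoℚ (suc (toℕ q))
  cancel : ∀ a K s t → a + (K - s) + (s + t - K) ≡ a + t
  cancel = solve-∀ ℚ-ring

dominant⇒shifted-< : ∀ {N} {x : Vector ℤ N} → Dominant x → ∀ {p q} → p Fin.< q →
  x q ℤ.+ + suc (toℕ p) ℤ.< x p ℤ.+ + suc (toℕ q)
dominant⇒shifted-< dominant p<q = ℤP.+-mono-≤-< (dominant _ _ (ℕP.<⇒≤ p<q)) (ℤ.+<+ (ℕ.s<s p<q))

dominant⇒plusρ-injective : ∀ {N} {x : Vector ℤ N} → Dominant x → Injective _≡_ _≡_ (plusρ x)
dominant⇒plusρ-injective {x = x} dominant {p} {q} xp+ρp≡xq+ρq with FP.<-cmp p q
... | tri≈ _ p≡q _ = p≡q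
... | tri< p<q _ _ = contradiction (sym (plusρ-≡⇒shifted-≡ x p q xp+ρp≡xq+ρq))
                                   (ℤP.<⇒≢ (dominant⇒shifted-< dominant p<q))
... | tri> _ _ q<p = contradiction (plusρ-≡⇒shifted-≡ x p q xp+ρp≡xq+ρq)
                                   (ℤP.<⇒≢ (dominant⇒shifted-< dominant q<p))

≗-act⇒injective : ∀ {N} (w : Permutation′ N) {x y : Vector ℚ N} → Injective _≡_ _≡_ y →
  (∀ k → x k ≡ act w y k) → Injective _≡_ _≡_ x
≗-act⇒injective w y-injective x≗wy {k} {l} xk≡xl = begin
  k                     ≡⟨ inverseʳ w ⟨
  w ⟨$⟩ʳ (w ⟨$⟩ˡ k)     ≡⟨ cong (w ⟨$⟩ʳ_) (y-injective (trans (sym (x≗wy k)) (trans xk≡xl (x≗wy l)))) ⟩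
  w ⟨$⟩ʳ (w ⟨$⟩ˡ l)     ≡⟨ inverseʳ w ⟩
  l                     ∎
  where open ≡-Reasoning

↑ˡ≢↑ʳ : ∀ {m n} (i : Fin m) (j : Fin n) → i ↑ˡ n ≢ m ↑ʳ j
↑ˡ≢↑ʳ {m} {n} i j i↑ˡn≡m↑ʳj
  with () ← trans (sym (FP.splitAt-↑ˡ m i n)) (trans (cong (splitAt m) i↑ˡn≡m↑ʳj) (FP.splitAt-↑ʳ m n j))

mainTheorem12 : (n n' : ℕ) → .{{_ : NonZero n}} → .{{_ : NonZero n'}} → 2 ∣ n →
  (μ : Vector ℤ n) → (μ' : Vector ℤ n') →
  Dominant μ → SymmetricA μ → Dominant μ' → SymmetricA μ' →
  (∀ (i : Fin n) (j : Fin n') → β μ i + β μ' j ≢ 0ℚ) →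
  (∃₂ λ (i : Fin n) (j : Fin n') → InHalf i × InHalf j ×
    ∣ aTilde μ μ' ∣ ≡ ∣ β μ i - β μ' j ∣) →
  ¬ (Σ (Permutation′ (n ℕ.+ n')) λ w → Σ (Vector ℤ (n ℕ.+ n')) λ lam →
    InWP n n' w × Dominant lam ×
    (∀ k → plusρ (μ ++ μ') k ≡ act w (plusρ lam) k))
mainTheorem12 n n' _ μ μ' _ symμ _ symμ' _ (i , j , _ , _ , ∣ã∣≡∣βi-β'j∣)
              (w , lam , _ , dominant , μ̃+ρ≡w[λ+ρ])
  with p , q , ã≡β'q-βp ← ∣aTilde∣≡∣β-difference∣⇒aTilde≡β-difference μ μ' symμ symμ' i j ∣ã∣≡∣βi-β'j∣
  = ↑ˡ≢↑ʳ p q (μ̃+ρ-injective (aTilde≡β-difference⇒collision μ μ' p q ã≡β'q-βp))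
  where
  μ̃+ρ-injective : Injective _≡_ _≡_ (plusρ (μ ++ μ'))
  μ̃+ρ-injective = ≗-act⇒injective w (dominant⇒plusρ-injective dominant) μ̃+ρ≡w[λ+ρ]
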